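{- Let $n>1$ be an integer and let $m_1,m_2,\ldots,m_{n-1}$ be integers with $\gcd(m_s,n)\le s$ for all $s=1,\ldots,n-1$. Then for any integers $a_1,\ldots,a_{n-1}$, there is a function $f:\{1,\ldots,n-1\}\to\{1,\ldots,n-1\}$ such that the sums $$f(1)+a_1,\ \ldots,\ f(n-1)+a_{n-1}$$ are pairwise distinct modulo $n$, and none of the numbers $f(1)m_1,\ \ldots,\ f(n-1)m_{n-1}$ is divisible by $n$.
   Context: $\gcd(a,n)$ denotes the greatest common divisor of the integer $a$ and the positive integer $n$ (with $\gcd(0,n)=n$). -}

module Defs where

{-# OPTIONS --safe #-}
-- Choose the values f(s) greedily, in order of decreasing s.  For 0 < k < n, n ∣ k m_s
-- forces k to be a nonzero multiple of n / gcd(m_s, n), so at most gcd(m_s, n) − 1 ≤ s − 1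
-- values are excluded by the divisibility condition; each of the n − 1 − s indices chosen
-- earlier excludes one more value, the unique k < n making the shifted sums congruent.
-- That excludes at most n − 2 of the n − 1 candidates.
module Submission where

open import Defs
open import Data.Nat using (ℕ; suc; _<_; _≤_; _∸_)
open import Data.Nat.GCD using (gcd)
open import Data.Fin using (Fin; toℕ)
open import Data.Integer using (ℤ; +_; _+_; _-_; _*_; ∣_∣)
open import Data.Integer.Divisibility using (_∣_)
open import Data.Product using (Σ; _×_)
open import Relation.Binary.PropositionalEquality using (_≡_)
open import Relation.Nullary using (¬_)

open import Data.Nat as ℕ using (zero; NonZero; pred)
open import Data.Nat.Properties
  using ( suc-injective; n<1+n; ≤-total; <⇒≱; >⇒≢; suc[m]≤n⇒m≤pred[n]; +-monoˡ-≤; pred-mono-≤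
        ; m+[n∸m]≡n; *-comm; *-assoc; *-cancelʳ-<; module ≤-Reasoning )
open import Data.Nat.Divisibility as ℕ∣ using (divides; _∣?_) renaming (_∣_ to _∣ℕ_)
open import Data.Nat.DivMod using (_/_; _%_; m<n⇒m%n≡m; %-remove-+ʳ; m/n*n≡m)
open import Data.Nat.GCD using (gcd[m,n]∣m; gcd[m,n]∣n; gcd[m,n]≢0)
open import Data.Nat.Coprimality using (coprime-/gcd; coprime-divisor)
import Data.Nat.Coprimality as Coprime
open import Data.Integer.Properties using (m-n≡m⊖n; ∣⊖∣-≤; ∣i-j∣≡∣j-i∣; abs-*)
open import Data.Integer.Divisibility.Signed using (∣ᵤ⇒∣; ∣⇒∣ᵤ; ∣m∣n⇒∣m-n)
open import Data.Integer.Tactic.RingSolver using (solve-∀)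
open import Data.Fin using (zero; suc; splitAt; _↑ˡ_; _↑ʳ_; fromℕ<)
open import Data.Fin.Properties
  using (any?; ¬∀⟶∃¬; injective⇒≤; toℕ-injective; toℕ<n; toℕ-fromℕ<; splitAt-↑ˡ; splitAt-↑ʳ)
open import Data.Vec.Functional using (_∷_)
open import Data.Product using (_,_; ∃; proj₁; proj₂; curry; map₂)
open import Data.Sum using (_⊎_; inj₁; inj₂; [_,_]′)
open import Function using (_∘_; Injective)
open import Relation.Nullary using (Dec; contradiction)
open import Relation.Binary.PropositionalEquality
  using (_≢_; refl; sym; trans; cong; subst; subst₂; module ≡-Reasoning)

Cofunctional : ∀ {V D} → (Fin V → Fin D → Set) → Set
Cofunctional R = ∀ {k k′ c} → R k c → R k′ c → k ≡ k′

∃-unrelated : ∀ {V D} (R : Fin V → Fin D → Set) → (∀ k c → Dec (R k c)) →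
              Cofunctional R → D < V →
              ∃ λ k → ∀ c → ¬ R k c
∃-unrelated {V} R R? cofunctional D<V =
  map₂ curry (¬∀⟶∃¬ V (λ k → ∃ (R k)) (λ k → any? (R? k)) ¬all-related)
  where
  ¬all-related : ¬ (∀ k → ∃ (R k))
  ¬all-related related = <⇒≱ D<V (injective⇒≤ code-injective)
    where
    code-injective : Injective _≡_ _≡_ (proj₁ ∘ related)
    code-injective {k} {k′} same =
      cofunctional (proj₂ (related k)) (subst (R k′) (sym same) (proj₂ (related k′)))

∃-unrelated₂ : ∀ {V D E} (R : Fin V → Fin D → Set) (S : Fin V → Fin E → Set) →
               (∀ k c → Dec (R k c)) → (∀ k c → Dec (S k c)) →
               Cofunctional R → Cofunctional S → D ℕ.+ E < V →
               ∃ λ k → (∀ c → ¬ R k c) × (∀ c → ¬ S k c)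
∃-unrelated₂ {D = D} {E} R S R? S? R-cofunctional S-cofunctional D+E<V =
  map₂ split (∃-unrelated R⊎S R⊎S? R⊎S-cofunctional D+E<V)
  where
  [R,S] : ∀ k → Fin D ⊎ Fin E → Set
  [R,S] k = [ R k , S k ]′

  R⊎S : Fin _ → Fin (D ℕ.+ E) → Set
  R⊎S k = [R,S] k ∘ splitAt D

  R⊎S? : ∀ k c → Dec (R⊎S k c)
  R⊎S? k c with splitAt D c
  ... | inj₁ c₁ = R? k c₁
  ... | inj₂ c₂ = S? k c₂

  R⊎S-cofunctional : Cofunctional R⊎S
  R⊎S-cofunctional {c = c} r r′ with splitAt D c
  ... | inj₁ _ = R-cofunctional r r′
  ... | inj₂ _ = S-cofunctional r r′

  split : ∀ {k} → (∀ c → ¬ R⊎S k c) → (∀ c → ¬ R k c) × (∀ c → ¬ S k c)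
  split {k} unrelated =
    (λ c → unrelated (c ↑ˡ E) ∘ subst ([R,S] k) (sym (splitAt-↑ˡ D c E))) ,
    (λ c → unrelated (D ↑ʳ c) ∘ subst ([R,S] k) (sym (splitAt-↑ʳ D E c)))

∣+k-+k′∣≡k′∸k : ∀ {k k′} → k ≤ k′ → ∣ + k - + k′ ∣ ≡ k′ ∸ k
∣+k-+k′∣≡k′∸k {k} {k′} k≤k′ = trans (cong ∣_∣ (m-n≡m⊖n k k′)) (∣⊖∣-≤ k≤k′)

≤-congruent⇒≡ : ∀ {n k k′} .{{_ : NonZero n}} → k ≤ k′ → k < n → k′ < n → n ∣ℕ k′ ∸ k → k ≡ k′
≤-congruent⇒≡ {n} {k} {k′} k≤k′ k<n k′<n n∣k′-k = begin
  k                     ≡⟨ m<n⇒m%n≡m k<n ⟨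
  k % n                 ≡⟨ %-remove-+ʳ k n∣k′-k ⟨
  (k ℕ.+ (k′ ∸ k)) % n  ≡⟨ cong (_% n) (m+[n∸m]≡n k≤k′) ⟩
  k′ % n                ≡⟨ m<n⇒m%n≡m k′<n ⟩
  k′                    ∎
  where open ≡-Reasoning

congruent⇒≡ : ∀ {n k k′} .{{_ : NonZero n}} → k < n → k′ < n → + n ∣ + k - + k′ → k ≡ k′
congruent⇒≡ {n} {k} {k′} k<n k′<n n∣k-k′ with ≤-total k k′
... | inj₁ k≤k′ = ≤-congruent⇒≡ k≤k′ k<n k′<n (subst (n ∣ℕ_) (∣+k-+k′∣≡k′∸k k≤k′) n∣k-k′)
... | inj₂ k′≤k = sym (≤-congruent⇒≡ k′≤k k′<n k<n
  (subst (n ∣ℕ_) (trans (∣i-j∣≡∣j-i∣ (+ k) (+ k′)) (∣+k-+k′∣≡k′∸k k′≤k)) n∣k-k′))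

gcd≢0ʳ : ∀ m n .{{_ : NonZero n}} → NonZero (gcd m n)
gcd≢0ʳ m n = ℕ.≢-nonZero (gcd[m,n]≢0 m n (inj₂ (ℕ.≢-nonZero⁻¹ n)))

n/gcd[m,n]∣k : ∀ {n k} m .{{_ : NonZero (gcd m n)}} → n ∣ℕ k ℕ.* m → n / gcd m n ∣ℕ k
n/gcd[m,n]∣k {n} {k} m n∣km =
  coprime-divisor (Coprime.sym (coprime-/gcd m n))
    (ℕ∣.*-cancelʳ-∣ (gcd m n) (subst₂ _∣ℕ_ (sym (m/n*n≡m (gcd[m,n]∣n m n))) km≡m′kd n∣km))
  where
  open ≡-Reasoning
  km≡m′kd : k ℕ.* m ≡ (m / gcd m n) ℕ.* k ℕ.* gcd m n
  km≡m′kd = begin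
    k ℕ.* m                              ≡⟨ cong (k ℕ.*_) (m/n*n≡m (gcd[m,n]∣m m n)) ⟨
    k ℕ.* ((m / gcd m n) ℕ.* gcd m n)    ≡⟨ *-assoc k _ _ ⟨
    k ℕ.* (m / gcd m n) ℕ.* gcd m n      ≡⟨ cong (ℕ._* gcd m n) (*-comm k _) ⟩
    (m / gcd m n) ℕ.* k ℕ.* gcd m n      ∎

multiple⇒code : ∀ {n k} m .{{_ : NonZero (gcd m n)}} → 0 < k → k < n → n ∣ℕ k ℕ.* m →
                ∃ λ (c : Fin (pred (gcd m n))) → suc (toℕ c) ℕ.* (n / gcd m n) ≡ k
multiple⇒code {n} {k} m 0<k k<n n∣km with n/gcd[m,n]∣k m n∣km
... | divides zero k≡0 = contradiction k≡0 (>⇒≢ 0<k)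
... | divides (suc c) k≡[1+c]q =
  fromℕ< c<pred[d] , trans (cong (λ x → suc x ℕ.* (n / gcd m n)) (toℕ-fromℕ< c<pred[d])) (sym k≡[1+c]q)
  where
  n≡dq : n ≡ gcd m n ℕ.* (n / gcd m n)
  n≡dq = trans (sym (m/n*n≡m (gcd[m,n]∣n m n))) (*-comm _ (gcd m n))

  c<pred[d] : c < pred (gcd m n)
  c<pred[d] = suc[m]≤n⇒m≤pred[n]
    (*-cancelʳ-< (n / gcd m n) (suc c) (gcd m n) (subst₂ _<_ k≡[1+c]q n≡dq k<n))

[x+b-u]-[y+b-u]≡x-y : ∀ x y b u → (x + b - u) - (y + b - u) ≡ x - y
[x+b-u]-[y+b-u]≡x-y = solve-∀

∣i-j⇒∣j-i : ∀ {n} i j → + n ∣ i - j → + n ∣ j - i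
∣i-j⇒∣j-i {n} i j = subst (n ∣ℕ_) (∣i-j∣≡∣j-i∣ i j)

shift : ∀ {V} → Fin V → ℤ → ℤ
shift k b = + suc (toℕ k) + b

shift-cofunctional : ∀ {V} {k k′ : Fin V} b u →
                     + suc V ∣ shift k b - u → + suc V ∣ shift k′ b - u → k ≡ k′
shift-cofunctional {V} {k} {k′} b u n∣ n∣′ =
  toℕ-injective (suc-injective (congruent⇒≡ (ℕ.s<s (toℕ<n k)) (ℕ.s<s (toℕ<n k′)) n∣1+k-1+k′))
  where
  n∣1+k-1+k′ : + suc V ∣ + suc (toℕ k) - + suc (toℕ k′)
  n∣1+k-1+k′ = subst (+ suc V ∣_) ([x+b-u]-[y+b-u]≡x-y (+ suc (toℕ k)) (+ suc (toℕ k′)) b u)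
    (∣⇒∣ᵤ (∣m∣n⇒∣m-n (∣ᵤ⇒∣ {+ suc V} {shift k b - u} n∣) (∣ᵤ⇒∣ {+ suc V} {shift k′ b - u} n∣′)))

PairwiseIncongruent : ∀ {V N} → (Fin N → Fin V) → (Fin N → ℤ) → Set
PairwiseIncongruent {V} f a = ∀ i j → i ≢ j → ¬ (+ suc V ∣ shift (f i) (a i) - shift (f j) (a j))

∷-pairwiseIncongruent : ∀ {V N} {f : Fin N → Fin V} {a : Fin (suc N) → ℤ} k →
                        PairwiseIncongruent f (a ∘ suc) →
                        (∀ j → ¬ (+ suc V ∣ shift k (a zero) - shift (f j) (a (suc j)))) →
                        PairwiseIncongruent (k ∷ f) a
∷-pairwiseIncongruent k incongruent new zero    zero    0≢0 = contradiction refl 0≢0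
∷-pairwiseIncongruent k incongruent new zero    (suc j) _   = new j
∷-pairwiseIncongruent {f = f} {a} k incongruent new (suc i) zero _ =
  new i ∘ ∣i-j⇒∣j-i (shift (f i) (a (suc i))) (shift k (a zero))
∷-pairwiseIncongruent k incongruent new (suc i) (suc j) i≢j = incongruent i j (i≢j ∘ cong suc)

-- N ∸ suc (toℕ i) indices are chosen before i: the recursion chooses index zero last.
∃-pairwiseIncongruent : ∀ {V N} (a : Fin N → ℤ) (d : Fin N → ℕ) (bad : ∀ i → Fin (d i) → ℕ) →
         (∀ i → d i ℕ.+ (N ∸ suc (toℕ i)) < V) →
         Σ (Fin N → Fin V) λ f → PairwiseIncongruent f a × (∀ i c → bad i c ≢ suc (toℕ (f i)))
∃-pairwiseIncongruent {N = zero} a d bad room = (λ ()) , (λ ()) , (λ ())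
∃-pairwiseIncongruent {V} {suc N} a d bad room
  with f , incongruent , avoids ← ∃-pairwiseIncongruent (a ∘ suc) (d ∘ suc) (bad ∘ suc) (room ∘ suc)
  with k , not-bad , no-clash ←
         ∃-unrelated₂ (λ k c → bad zero c ≡ suc (toℕ k))
                      (λ k j → + suc V ∣ shift k (a zero) - shift (f j) (a (suc j)))
                      (λ k c → bad zero c ℕ.≟ suc (toℕ k))
                      (λ k j → suc V ∣? _)
                      (λ p q → toℕ-injective (suc-injective (trans (sym p) q)))
                      (shift-cofunctional (a zero) _)
                      (room zero)
  = k ∷ f , ∷-pairwiseIncongruent {f = f} {a} k incongruent no-clash , λ where
      zero    → not-bad
      (suc i) → avoids i

pred[g]+[V∸1+i]<V : ∀ {V} g (i : Fin V) → g ≤ suc (toℕ i) → pred g ℕ.+ (V ∸ suc (toℕ i)) < V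
pred[g]+[V∸1+i]<V {V} g i g≤1+i = begin-strict
  pred g ℕ.+ (V ∸ suc (toℕ i))        ≤⟨ +-monoˡ-≤ _ (pred-mono-≤ g≤1+i) ⟩
  toℕ i ℕ.+ (V ∸ suc (toℕ i))         <⟨ n<1+n _ ⟩
  suc (toℕ i) ℕ.+ (V ∸ suc (toℕ i))   ≡⟨ m+[n∸m]≡n (toℕ<n i) ⟩
  V                                   ∎
  where open ≤-Reasoning

theorem1p3 : (n : ℕ) → 1 < n →
    (m : Fin (n ∸ 1) → ℤ) →
    ((s : Fin (n ∸ 1)) → gcd ∣ m s ∣ n ≤ suc (toℕ s)) →
    (a : Fin (n ∸ 1) → ℤ) →
    Σ (Fin (n ∸ 1) → Fin (n ∸ 1)) (λ f →
      ((i j : Fin (n ∸ 1)) → ¬ (i ≡ j) →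
        ¬ ((+ n) ∣ ((+ suc (toℕ (f i)) + a i) - (+ suc (toℕ (f j)) + a j))))
      × ((i : Fin (n ∸ 1)) → ¬ ((+ n) ∣ ((+ suc (toℕ (f i))) * m i))))
theorem1p3 zero () m gcd≤ a
theorem1p3 (suc V) _ m gcd≤ a =
  let f , incongruent , avoids =
        ∃-pairwiseIncongruent a codes multiples (λ i → pred[g]+[V∸1+i]<V _ i (gcd≤ i))
  in f , incongruent , λ i n∣[1+fi]mi →
       let c , c-multiple =
             multiple⇒code ∣ m i ∣ {{gcd≢0ʳ ∣ m i ∣ (suc V)}} ℕ.z<s (ℕ.s<s (toℕ<n (f i)))
               (subst (suc V ∣ℕ_) (abs-* (+ suc (toℕ (f i))) (m i)) n∣[1+fi]mi)
       in avoids i c c-multiple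
  where
  codes : Fin V → ℕ
  codes i = pred (gcd ∣ m i ∣ (suc V))

  multiples : ∀ i → Fin (codes i) → ℕ
  multiples i c = suc (toℕ c) ℕ.* (suc V / gcd ∣ m i ∣ (suc V)) {{gcd≢0ʳ ∣ m i ∣ (suc V)}}
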